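{- Let $\Gamma$ be a strictly Deza graph with parameters $(n,k,b,a)$ such that $k=b+1$ and $\beta(\Gamma)>1$. Let $x$ be a vertex of type (A), let $y\in N(x)$ be nonadjacent to some $x_i\in B(x)$, and let $z\in N_2(x)$ be adjacent to $x_i$. Then (1) $N(x)\cap N(y)=N(x)\cap N(z)$; (2) $B[v]\subseteq N(x)\cap N(y)$ for every vertex $v\in N(x)\cap N(y)$.
   Context: Graphs are finite, simple, undirected. $N(v)$ is the neighbourhood of $v$ and $N_2(v)$ the set of vertices at distance $2$ from $v$. A Deza graph with parameters $(n,k,b,a)$, $b\ge a$, is a nonempty $k$-regular graph on $n$ vertices in which every pair of distinct vertices has exactly $b$ or exactly $a$ common neighbours; it is strictly Deza if it has diameter $2$ and is not strongly regular. $B(v)=\{u: |N(u)\cap N(v)|=b\}$, $B[v]=B(v)\cup\{v\}$; $\beta(\Gamma)=|B(v)|$ (independent of $v$). A vertex $v$ is of type (A) if $B(v)\cap N(v)=\emptyset$. -}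

module Defs where

open import Data.Nat using (ℕ; _≤_; _<_)
open import Data.Bool using (Bool; true; false)
open import Data.Fin using (Fin)
open import Data.Fin.Subset using (Subset; _∩_; ∣_∣)
open import Data.Vec using (tabulate)
open import Data.Product using (Σ; ∃; _×_)
open import Data.Sum using (_⊎_)
open import Relation.Nullary using (¬_)
open import Relation.Binary.PropositionalEquality using (_≡_; _≢_)

record Graph (n : ℕ) : Set where
  field
    adj        : Fin n → Fin n → Bool
    adj-sym    : ∀ u v → adj u v ≡ adj v u
    adj-irrefl : ∀ v → adj v v ≡ false
open Graph public

module _ {n : ℕ} (Γ : Graph n) where

  Adj : Fin n → Fin n → Set
  Adj u v = adj Γ u v ≡ true

  N : Fin n → Subset n
  N v = tabulate (adj Γ v)

  deg : Fin n → ℕ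
  deg v = ∣ N v ∣

  common : Fin n → Fin n → ℕ
  common u v = ∣ N u ∩ N v ∣

  Regular : ℕ → Set
  Regular k = ∀ v → deg v ≡ k

  IsDeza : ℕ → ℕ → ℕ → Set
  IsDeza k b a =
    1 ≤ n × Regular k × a ≤ b ×
    (∀ u v → u ≢ v → common u v ≡ b ⊎ common u v ≡ a)

  Dist2 : Fin n → Fin n → Set
  Dist2 x z = x ≢ z × ¬ Adj x z × ∃ λ w → Adj x w × Adj w z

  Diameter2 : Set
  Diameter2 =
    (∀ u v → u ≢ v → Adj u v ⊎ (∃ λ w → Adj u w × Adj w v)) ×
    (∃ λ u → ∃ λ v → u ≢ v × ¬ Adj u v)

  StronglyRegular : Set
  StronglyRegular = ∃ λ k → ∃ λ λ' → ∃ λ μ →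
    Regular k ×
    (∀ u v → u ≢ v → Adj u v → common u v ≡ λ') ×
    (∀ u v → u ≢ v → ¬ Adj u v → common u v ≡ μ)

  IsStrictlyDeza : ℕ → ℕ → ℕ → Set
  IsStrictlyDeza k b a = IsDeza k b a × Diameter2 × ¬ StronglyRegular

  Bset : ℕ → Fin n → Subset n
  Bset b v = tabulate (λ u → isB u)
    where
    open import Data.Nat using (_≡ᵇ_)
    isB : Fin n → Bool
    isB u = common u v ≡ᵇ b

  InB : ℕ → Fin n → Fin n → Set
  InB b v u = common u v ≡ b

  InB[] : ℕ → Fin n → Fin n → Set
  InB[] b v u = u ≡ v ⊎ InB b v u

  beta : ℕ → Fin n → ℕ
  beta b v = ∣ Bset b v ∣

  TypeA : ℕ → Fin n → Set
  TypeA b x = ∀ u → Adj x u → ¬ InB b x u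

-- Let T = N(x) ∩ N(xi). As k = b + 1 and xi ∈ B(x), N(x) = T ∪ {y} and N(xi) = T ∪ {z}. Everything
-- rests on one count: if u and v have b = k - 1 common neighbours, u misses at most one neighbour of v.
-- Applied to w and xi it shows that a common neighbour w ≠ y of x and z is adjacent to y. If y ~ z,
-- comparing the common neighbours of x, z with those of z, xi forces b = a + 1 and N(x) ∩ N(y) ⊆ N(z),
-- so a vertex of N(x) ∩ N(y) has the three neighbours x, xi, z outside N(x), one too many; when a = 0 the
-- graph is 2-regular of diameter 2, i.e. the pentagon, which is strongly regular. So y ≁ z, whence
-- N(x) ∩ N(z) ⊆ N(x) ∩ N(y), with equality as both have a elements. For (2), v ∈ N(x) ∩ N(y) is adjacent
-- to x, y, xi and z, and u ∈ B(v) misses at most one of them, which the facts above show is neither x nor y.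
module Submission where

open import Defs
open import Data.Nat using (ℕ; suc; _<_; _≤_; _+_; s≤s; z≤n)
open import Data.Nat.Properties
  using (≤-refl; ≤-reflexive; ≤-trans; ≤-<-trans; <-≤-trans; ≤-antisym; <-irrefl; <⇒≢; ≤∧≢⇒<; n≤1+n; n≢0⇒n>0)
open import Data.Bool using (true)
import Data.Bool.Properties as Bool
open import Data.Fin using (Fin; zero; suc)
open import Data.Fin.Properties using (_≟_)
open import Data.Fin.Subset using (Subset; _∈_; _∉_; _⊆_; _∩_; _-_; ∣_∣; Nonempty; inside; outside)
open import Data.Fin.Subset.Properties
  using (_∈?_; nonempty?; Empty-unique; ∣⊥∣≡0; ∉⊥; ⊥⊆; p─⊥≡p; p─q⊆p; p⊆q⇒∣p∣≤∣q∣; p⊂q⇒∣p∣<∣q∣;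
         x∈p⇒∣p-x∣<∣p∣; x∈p∧x≢y⇒x∈p-y; x∈p∩q⁺; x∈p∩q⁻; p∩q⊆p; p∩q⊆q; ∩-comm; ∩-idem)
open import Data.Vec using (_∷_; there)
open import Data.Vec.Properties using ([]=⇒lookup; lookup⇒[]=; lookup∘tabulate)
open import Data.Product using (_×_; _,_; proj₁; proj₂; uncurry; map)
open import Data.Sum using (_⊎_; inj₁; inj₂; [_,_]′; reduce)
open import Function using (_∘_)
open import Relation.Nullary using (¬_; Dec; yes; no; contradiction)
open import Relation.Nullary.Decidable using (decidable-stable)
open import Relation.Binary.PropositionalEquality

private variable
  n : ℕ
  p q : Subset n
  i j l : Fin n

∣p∣≤1+∣p-x∣ : ∀ (p : Subset n) i → ∣ p ∣ ≤ suc ∣ p - i ∣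
∣p∣≤1+∣p-x∣ (inside  ∷ p) zero    = subst (λ r → suc ∣ p ∣ ≤ suc ∣ r ∣) (sym (p─⊥≡p p)) ≤-refl
∣p∣≤1+∣p-x∣ (outside ∷ p) zero    = subst (λ r → ∣ p ∣ ≤ suc ∣ r ∣) (sym (p─⊥≡p p)) (n≤1+n _)
∣p∣≤1+∣p-x∣ (inside  ∷ p) (suc i) = s≤s (∣p∣≤1+∣p-x∣ p i)
∣p∣≤1+∣p-x∣ (outside ∷ p) (suc i) = ∣p∣≤1+∣p-x∣ p i

x∉p-x : ∀ (p : Subset n) i → i ∉ p - i
x∉p-x (s ∷ p) zero    ()
x∉p-x (s ∷ p) (suc i) (there i∈p-i) = x∉p-x p i i∈p-i

⊆-except-one⇒∣p∣≤1+∣q∣ : (∀ {j} → j ∈ p → j ≢ i → j ∈ q) → ∣ p ∣ ≤ suc ∣ q ∣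
⊆-except-one⇒∣p∣≤1+∣q∣ {p = p} {i = i} p⊆q∪i =
  ≤-trans (∣p∣≤1+∣p-x∣ p i) (s≤s (p⊆q⇒∣p∣≤∣q∣ λ {j} j∈p-i →
    p⊆q∪i (p─q⊆p _ _ j∈p-i) λ { refl → x∉p-x p j j∈p-i }))

p⊆q∧x∉p⇒p⊆q-x : p ⊆ q → i ∉ p → p ⊆ q - i
p⊆q∧x∉p⇒p⊆q-x p⊆q i∉p j∈p = x∈p∧x≢y⇒x∈p-y (p⊆q j∈p) λ { refl → i∉p j∈p }

two-outside⇒2+∣p∣≤∣q∣ : p ⊆ q → i ∈ q → j ∈ q → i ∉ p → j ∉ p → i ≢ j → 2 + ∣ p ∣ ≤ ∣ q ∣
two-outside⇒2+∣p∣≤∣q∣ p⊆q i∈q j∈q i∉p j∉p i≢j =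
  ≤-trans (s≤s (p⊂q⇒∣p∣<∣q∣ (p⊆q∧x∉p⇒p⊆q-x p⊆q i∉p , _ , x∈p∧x≢y⇒x∈p-y j∈q (≢-sym i≢j) , j∉p)))
          (x∈p⇒∣p-x∣<∣p∣ i∈q)

three-outside⇒3+∣p∣≤∣q∣ : p ⊆ q → i ∈ q → j ∈ q → l ∈ q → i ∉ p → j ∉ p → l ∉ p →
                          i ≢ j → i ≢ l → j ≢ l → 3 + ∣ p ∣ ≤ ∣ q ∣
three-outside⇒3+∣p∣≤∣q∣ p⊆q i∈q j∈q l∈q i∉p j∉p l∉p i≢j i≢l j≢l =
  ≤-trans (s≤s (two-outside⇒2+∣p∣≤∣q∣ (p⊆q∧x∉p⇒p⊆q-x p⊆q i∉p)
                  (x∈p∧x≢y⇒x∈p-y j∈q (≢-sym i≢j)) (x∈p∧x≢y⇒x∈p-y l∈q (≢-sym i≢l)) j∉p l∉p j≢l))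
          (x∈p⇒∣p-x∣<∣p∣ i∈q)

∣q∣≤1+∣p∣⇒outside-unique : p ⊆ q → ∣ q ∣ ≤ suc ∣ p ∣ → i ∈ q → j ∈ q → i ∉ p → j ∉ p → i ≡ j
∣q∣≤1+∣p∣⇒outside-unique {i = i} {j = j} p⊆q ∣q∣≤1+∣p∣ i∈q j∈q i∉p j∉p with i ≟ j
... | yes i≡j = i≡j
... | no  i≢j = contradiction (≤-trans (two-outside⇒2+∣p∣≤∣q∣ p⊆q i∈q j∈q i∉p j∉p i≢j) ∣q∣≤1+∣p∣) (<-irrefl refl)

p⊆q∧∣q∣≤∣p∣⇒q⊆p : p ⊆ q → ∣ q ∣ ≤ ∣ p ∣ → q ⊆ p
p⊆q∧∣q∣≤∣p∣⇒q⊆p {p = p} p⊆q ∣q∣≤∣p∣ {i} i∈q with i ∈? p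
... | yes i∈p = i∈p
... | no  i∉p = contradiction (<-≤-trans (p⊂q⇒∣p∣<∣q∣ (p⊆q , i , i∈q , i∉p)) ∣q∣≤∣p∣) (<-irrefl refl)

0<∣p∣⇒Nonempty : ∀ {n} {p : Subset n} → 0 < ∣ p ∣ → Nonempty p
0<∣p∣⇒Nonempty {n} {p} 0<∣p∣ with nonempty? p
... | yes p≠∅ = p≠∅
... | no  p=∅ = contradiction (trans (cong ∣_∣ (Empty-unique p=∅)) (∣⊥∣≡0 n)) (≢-sym (<⇒≢ 0<∣p∣))

module Neighbourhoods {n : ℕ} (Γ : Graph n) where

  Adj? : ∀ u v → Dec (Adj Γ u v)
  Adj? u v = adj Γ u v Bool.≟ true

  Adj-sym : ∀ {u v} → Adj Γ u v → Adj Γ v u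
  Adj-sym {u} {v} u~v = trans (adj-sym Γ v u) u~v

  Adj⇒≢ : ∀ {u v} → Adj Γ u v → u ≢ v
  Adj⇒≢ {u} u~u refl with trans (sym u~u) (adj-irrefl Γ u)
  ... | ()

  Adj⇒∈N : ∀ {u v} → Adj Γ u v → v ∈ N Γ u
  Adj⇒∈N {u} {v} u~v = lookup⇒[]= v _ (trans (lookup∘tabulate (adj Γ u) v) u~v)

  ∈N⇒Adj : ∀ {u v} → v ∈ N Γ u → Adj Γ u v
  ∈N⇒Adj {u} {v} v∈Nu = trans (sym (lookup∘tabulate (adj Γ u) v)) ([]=⇒lookup v∈Nu)

  Adj⇒∈common : ∀ {u v w} → Adj Γ u w → Adj Γ v w → w ∈ N Γ u ∩ N Γ v
  Adj⇒∈common u~w v~w = x∈p∩q⁺ (Adj⇒∈N u~w , Adj⇒∈N v~w)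

  ∈common⇒Adj : ∀ {u v w} → w ∈ N Γ u ∩ N Γ v → Adj Γ u w × Adj Γ v w
  ∈common⇒Adj {u} {v} w∈ = map ∈N⇒Adj ∈N⇒Adj (x∈p∩q⁻ (N Γ u) (N Γ v) w∈)

  common-neighbours-⊆ : ∀ {u v u′ v′} → (∀ {w} → Adj Γ u w → Adj Γ v w → Adj Γ u′ w × Adj Γ v′ w) →
                        N Γ u ∩ N Γ v ⊆ N Γ u′ ∩ N Γ v′
  common-neighbours-⊆ f w∈ = uncurry Adj⇒∈common (uncurry f (∈common⇒Adj w∈))

  common-sym : ∀ u v → common Γ u v ≡ common Γ v u
  common-sym u v = cong ∣_∣ (∩-comm (N Γ u) (N Γ v))

  common-self : ∀ v → common Γ v v ≡ deg Γ v
  common-self v = cong ∣_∣ (∩-idem (N Γ v))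

  unshared-neighbour-unique : ∀ {b u v w w′} → Regular Γ (suc b) → common Γ u v ≡ b →
    Adj Γ v w → Adj Γ v w′ → ¬ Adj Γ u w → ¬ Adj Γ u w′ → w ≡ w′
  unshared-neighbour-unique {u = u} {v} reg uv≡b v~w v~w′ u≁w u≁w′ =
    ∣q∣≤1+∣p∣⇒outside-unique (p∩q⊆q (N Γ u) (N Γ v)) (≤-reflexive (trans (reg v) (cong suc (sym uv≡b))))
      (Adj⇒∈N v~w) (Adj⇒∈N v~w′) (u≁w ∘ proj₁ ∘ ∈common⇒Adj) (u≁w′ ∘ proj₁ ∘ ∈common⇒Adj)

module DezaCommon {n : ℕ} (Γ : Graph n) {k b a : ℕ} (deza : IsDeza Γ k b a) where

  common≡b⊎a : ∀ {u v} → u ≢ v → common Γ u v ≡ b ⊎ common Γ u v ≡ a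
  common≡b⊎a = proj₂ (proj₂ (proj₂ deza)) _ _

  a≤common : ∀ {u v} → u ≢ v → a ≤ common Γ u v
  a≤common u≢v with common≡b⊎a u≢v
  ... | inj₁ uv≡b = ≤-trans (proj₁ (proj₂ (proj₂ deza))) (≤-reflexive (sym uv≡b))
  ... | inj₂ uv≡a = ≤-reflexive (sym uv≡a)

  a<common⇒common≡b : ∀ {u v} → u ≢ v → a < common Γ u v → common Γ u v ≡ b
  a<common⇒common≡b u≢v a<uv with common≡b⊎a u≢v
  ... | inj₁ uv≡b = uv≡b
  ... | inj₂ uv≡a = contradiction a<uv (<-irrefl (sym uv≡a))

  common≢b⇒common≡a : ∀ {u v} → u ≢ v → common Γ u v ≢ b → common Γ u v ≡ a
  common≢b⇒common≡a u≢v uv≢b with common≡b⊎a u≢v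
  ... | inj₁ uv≡b = contradiction uv≡b uv≢b
  ... | inj₂ uv≡a = uv≡a

Deza-b-b⇒SRG : ∀ (Γ : Graph n) {k b} → IsDeza Γ k b b → StronglyRegular Γ
Deza-b-b⇒SRG Γ {k} {b} (_ , reg , _ , common≡b⊎b) =
  k , b , b , reg , (λ u v u≢v _ → reduce (common≡b⊎b u v u≢v)) , (λ u v u≢v _ → reduce (common≡b⊎b u v u≢v))

strictly-Deza⇒a<b : ∀ (Γ : Graph n) {k b a} → IsStrictlyDeza Γ k b a → a < b
strictly-Deza⇒a<b Γ (deza@(_ , _ , a≤b , _) , _ , ¬SRG) = ≤∧≢⇒< a≤b λ { refl → ¬SRG (Deza-b-b⇒SRG Γ deza) }

module TwoRegular {n : ℕ} (Γ : Graph n) (reg : Regular Γ 2) where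
  open Neighbourhoods Γ

  neighbours-of-2-regular : ∀ {u v w r} → Adj Γ u v → Adj Γ u w → v ≢ w → Adj Γ u r → r ≡ v ⊎ r ≡ w
  neighbours-of-2-regular {u} {v} {w} {r} u~v u~w v≢w u~r with r ≟ v | r ≟ w
  ... | yes r≡v | _       = inj₁ r≡v
  ... | no  _   | yes r≡w = inj₂ r≡w
  ... | no  r≢v | no  r≢w = contradiction
        (subst₂ (λ m m′ → 3 + m ≤ m′) (∣⊥∣≡0 n) (reg u)
          (three-outside⇒3+∣p∣≤∣q∣ ⊥⊆ (Adj⇒∈N u~v) (Adj⇒∈N u~w) (Adj⇒∈N u~r) ∉⊥ ∉⊥ ∉⊥
            v≢w (≢-sym r≢v) (≢-sym r≢w)))
        λ { (s≤s (s≤s ())) }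

  diameter-2⇒triangle-free : Diameter2 Γ → ∀ {u v w} → Adj Γ u v → Adj Γ u w → ¬ Adj Γ v w
  diameter-2⇒triangle-free (connected , s , t , s≢t , s≁t) {u} {v} {w} u~v u~w v~w =
    s≁t (clique (spans s) (spans t) s≢t)
    where
    Triangle : Fin n → Set
    Triangle r = r ≡ u ⊎ r ≡ v ⊎ r ≡ w

    closed : ∀ {r r′} → Triangle r → Adj Γ r r′ → Triangle r′
    closed (inj₁ refl) r~r′ = inj₂ (neighbours-of-2-regular u~v u~w (Adj⇒≢ v~w) r~r′)
    closed (inj₂ (inj₁ refl)) r~r′ =
      [ inj₁ , inj₂ ∘ inj₂ ]′ (neighbours-of-2-regular (Adj-sym u~v) v~w (Adj⇒≢ u~w) r~r′)
    closed (inj₂ (inj₂ refl)) r~r′ =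
      [ inj₁ , inj₂ ∘ inj₁ ]′ (neighbours-of-2-regular (Adj-sym u~w) (Adj-sym v~w) (Adj⇒≢ u~v) r~r′)

    spans : ∀ r → Triangle r
    spans r with r ≟ u
    ... | yes r≡u = inj₁ r≡u
    ... | no  r≢u with connected u r (≢-sym r≢u)
    ...   | inj₁ u~r            = closed (inj₁ refl) u~r
    ...   | inj₂ (m , u~m , m~r) = closed (closed (inj₁ refl) u~m) m~r

    clique : ∀ {r r′} → Triangle r → Triangle r′ → r ≢ r′ → Adj Γ r r′
    clique (inj₁ refl)        (inj₁ refl)        r≢r′ = contradiction refl r≢r′
    clique (inj₁ refl)        (inj₂ (inj₁ refl)) _    = u~v
    clique (inj₁ refl)        (inj₂ (inj₂ refl)) _    = u~w
    clique (inj₂ (inj₁ refl)) (inj₁ refl)        _    = Adj-sym u~v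
    clique (inj₂ (inj₁ refl)) (inj₂ (inj₁ refl)) r≢r′ = contradiction refl r≢r′
    clique (inj₂ (inj₁ refl)) (inj₂ (inj₂ refl)) _    = v~w
    clique (inj₂ (inj₂ refl)) (inj₁ refl)        _    = Adj-sym u~w
    clique (inj₂ (inj₂ refl)) (inj₂ (inj₁ refl)) _    = Adj-sym v~w
    clique (inj₂ (inj₂ refl)) (inj₂ (inj₂ refl)) r≢r′ = contradiction refl r≢r′

Deza-1-0∧triangle-free⇒SRG : ∀ (Γ : Graph n) {k} → IsDeza Γ k 1 0 → Diameter2 Γ →
  (∀ {u v w} → Adj Γ u v → Adj Γ u w → ¬ Adj Γ v w) → StronglyRegular Γ
Deza-1-0∧triangle-free⇒SRG Γ {k} deza (connected , _) triangle-free =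
  k , 0 , 1 , proj₁ (proj₂ deza) , adjacent , non-adjacent
  where
  open Neighbourhoods Γ
  open DezaCommon Γ deza

  adjacent : ∀ u v → u ≢ v → Adj Γ u v → common Γ u v ≡ 0
  adjacent u v u≢v u~v with common≡b⊎a u≢v
  ... | inj₂ uv≡0 = uv≡0
  ... | inj₁ uv≡1 with 0<∣p∣⇒Nonempty (subst (0 <_) (sym uv≡1) (s≤s z≤n))
  ...   | w , w∈ = contradiction (proj₂ (∈common⇒Adj w∈)) (triangle-free u~v (proj₁ (∈common⇒Adj w∈)))

  non-adjacent : ∀ u v → u ≢ v → ¬ Adj Γ u v → common Γ u v ≡ 1
  non-adjacent u v u≢v u≁v with common≡b⊎a u≢v | connected u v u≢v
  ... | inj₁ uv≡1 | _                     = uv≡1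
  ... | inj₂ _    | inj₁ u~v              = contradiction u~v u≁v
  ... | inj₂ uv≡0 | inj₂ (w , u~w , w~v) =
        contradiction uv≡0 (≢-sym (<⇒≢ (≤-trans (s≤s z≤n) (x∈p⇒∣p-x∣<∣p∣ (Adj⇒∈common u~w (Adj-sym w~v))))))

module Configuration {n : ℕ} (Γ : Graph n) {k b a : ℕ}
  (strict : IsStrictlyDeza Γ k b a) (k≡1+b : k ≡ suc b)
  {x y xi z : Fin n} (typeA : TypeA Γ b x)
  (x~y : Adj Γ x y) (xi∈B⟨x⟩ : InB Γ b x xi) (y≁xi : ¬ Adj Γ y xi)
  (z∈N₂⟨x⟩ : Dist2 Γ x z) (z~xi : Adj Γ z xi) where

  open Neighbourhoods Γ
  private
    deza = proj₁ strict
  open DezaCommon Γ deza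

  regular : Regular Γ (suc b)
  regular v = trans (proj₁ (proj₂ deza) v) k≡1+b

  x≁z : ¬ Adj Γ x z
  x≁z = proj₁ (proj₂ z∈N₂⟨x⟩)

  x≁xi : ¬ Adj Γ x xi
  x≁xi x~xi = typeA xi x~xi xi∈B⟨x⟩

  x≢xi : x ≢ xi
  x≢xi refl = <-irrefl (trans (sym xi∈B⟨x⟩) (trans (common-self x) (regular x))) ≤-refl

  x≢z : x ≢ z
  x≢z = proj₁ z∈N₂⟨x⟩

  x≢y : x ≢ y
  x≢y = Adj⇒≢ x~y

  y≢xi : y ≢ xi
  y≢xi refl = x≁xi x~y

  y≢z : y ≢ z
  y≢z refl = x≁z x~y

  neighbour⇒common≡a : ∀ {w} → Adj Γ x w → common Γ w x ≡ a
  neighbour⇒common≡a x~w = common≢b⇒common≡a (≢-sym (Adj⇒≢ x~w)) (typeA _ x~w)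

  x~w⇒xi~w : ∀ {w} → Adj Γ x w → w ≢ y → Adj Γ xi w
  x~w⇒xi~w {w} x~w w≢y = decidable-stable (Adj? xi w) λ xi≁w →
    w≢y (unshared-neighbour-unique regular xi∈B⟨x⟩ x~w x~y xi≁w (y≁xi ∘ Adj-sym))

  xi~w⇒x~w : ∀ {w} → Adj Γ xi w → w ≢ z → Adj Γ x w
  xi~w⇒x~w {w} xi~w w≢z = decidable-stable (Adj? x w) λ x≁w →
    w≢z (unshared-neighbour-unique regular (trans (common-sym x xi) xi∈B⟨x⟩) xi~w (Adj-sym z~xi) x≁w x≁z)

  -- Otherwise N(w) ∩ N(x) ⊂ N(w) ∩ N(xi) (witness z), so w and xi share b neighbours,
  -- yet N(xi) misses the two neighbours x and xi of w.
  x~w∧z~w⇒y~w : ∀ {w} → Adj Γ x w → Adj Γ z w → w ≢ y → Adj Γ y w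
  x~w∧z~w⇒y~w {w} x~w z~w w≢y = decidable-stable (Adj? y w) λ y≁w →
    x≢xi (unshared-neighbour-unique regular (common⟨xi,w⟩≡b y≁w)
            (Adj-sym x~w) (Adj-sym xi~w) (x≁xi ∘ Adj-sym) λ xi~xi → Adj⇒≢ xi~xi refl)
    where
    xi~w : Adj Γ xi w
    xi~w = x~w⇒xi~w x~w w≢y

    common⟨w,x⟩<common⟨w,xi⟩ : ¬ Adj Γ y w → common Γ w x < common Γ w xi
    common⟨w,x⟩<common⟨w,xi⟩ y≁w = p⊂q⇒∣p∣<∣q∣
      ( common-neighbours-⊆ (λ w~v x~v → w~v , x~w⇒xi~w x~v λ { refl → y≁w (Adj-sym w~v) })
      , z , Adj⇒∈common (Adj-sym z~w) (Adj-sym z~xi) , x≁z ∘ proj₂ ∘ ∈common⇒Adj )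

    common⟨xi,w⟩≡b : ¬ Adj Γ y w → common Γ xi w ≡ b
    common⟨xi,w⟩≡b y≁w = trans (common-sym xi w)
      (a<common⇒common≡b (≢-sym (Adj⇒≢ xi~w))
        (≤-<-trans (a≤common (≢-sym (Adj⇒≢ x~w))) (common⟨w,x⟩<common⟨w,xi⟩ y≁w)))

  x~w∧xi~w∧z~w⇒3+a≤1+b : ∀ {w} → Adj Γ x w → Adj Γ xi w → Adj Γ z w → 3 + a ≤ suc b
  x~w∧xi~w∧z~w⇒3+a≤1+b {w} x~w xi~w z~w =
    subst₂ (λ m m′ → 3 + m ≤ m′) (neighbour⇒common≡a x~w) (regular w)
      (three-outside⇒3+∣p∣≤∣q∣ (p∩q⊆p (N Γ w) (N Γ x))
        (Adj⇒∈N (Adj-sym x~w)) (Adj⇒∈N (Adj-sym xi~w)) (Adj⇒∈N (Adj-sym z~w))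
        (λ x∈ → Adj⇒≢ (proj₂ (∈common⇒Adj x∈)) refl) (x≁xi ∘ proj₂ ∘ ∈common⇒Adj) (x≁z ∘ proj₂ ∘ ∈common⇒Adj)
        x≢xi x≢z (≢-sym (Adj⇒≢ z~xi)))

  common⟨x,y⟩≡a : common Γ x y ≡ a
  common⟨x,y⟩≡a = trans (common-sym x y) (neighbour⇒common≡a x~y)

  a<b : a < b
  a<b = strictly-Deza⇒a<b Γ strict

  module _ (y~z : Adj Γ y z) where

    N⟨z⟩∩N⟨xi⟩⊆N⟨x⟩∩N⟨y⟩ : N Γ z ∩ N Γ xi ⊆ N Γ x ∩ N Γ y
    N⟨z⟩∩N⟨xi⟩⊆N⟨x⟩∩N⟨y⟩ = common-neighbours-⊆ λ z~w xi~w →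
      let x~w = xi~w⇒x~w xi~w (≢-sym (Adj⇒≢ z~w)) in
      x~w , x~w∧z~w⇒y~w x~w z~w λ { refl → y≁xi (Adj-sym xi~w) }

    common⟨z,xi⟩<common⟨x,z⟩ : common Γ z xi < common Γ x z
    common⟨z,xi⟩<common⟨x,z⟩ = p⊂q⇒∣p∣<∣q∣
      ( common-neighbours-⊆ (λ z~w xi~w → xi~w⇒x~w xi~w (≢-sym (Adj⇒≢ z~w)) , z~w)
      , y , Adj⇒∈common x~y (Adj-sym y~z) , y≁xi ∘ Adj-sym ∘ proj₂ ∘ ∈common⇒Adj )

    common⟨x,z⟩≡b : common Γ x z ≡ b
    common⟨x,z⟩≡b = a<common⇒common≡b x≢z (≤-<-trans (a≤common (Adj⇒≢ z~xi)) common⟨z,xi⟩<common⟨x,z⟩)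

    b≡1+a : b ≡ suc a
    b≡1+a = ≤-antisym b≤1+a a<b
      where
      b≤1+a : b ≤ suc a
      b≤1+a = subst₂ (λ m m′ → m ≤ suc m′) common⟨x,z⟩≡b common⟨x,y⟩≡a
        (⊆-except-one⇒∣p∣≤1+∣q∣ λ w∈ w≢y →
          let (x~w , z~w) = ∈common⇒Adj w∈ in Adj⇒∈common x~w (x~w∧z~w⇒y~w x~w z~w w≢y))

    N⟨x⟩∩N⟨y⟩⊆N⟨z⟩∩N⟨xi⟩ : N Γ x ∩ N Γ y ⊆ N Γ z ∩ N Γ xi
    N⟨x⟩∩N⟨y⟩⊆N⟨z⟩∩N⟨xi⟩ = p⊆q∧∣q∣≤∣p∣⇒q⊆p N⟨z⟩∩N⟨xi⟩⊆N⟨x⟩∩N⟨y⟩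
      (subst (_≤ common Γ z xi) (sym common⟨x,y⟩≡a) (a≤common (Adj⇒≢ z~xi)))

    a≢0 : a ≢ 0
    a≢0 refl = proj₂ (proj₂ strict)
      (Deza-1-0∧triangle-free⇒SRG Γ (subst (λ c → IsDeza Γ k c 0) b≡1+a deza) diameter-2
        (TwoRegular.diameter-2⇒triangle-free Γ (subst (λ c → Regular Γ (suc c)) b≡1+a regular) diameter-2))
      where
      diameter-2 : Diameter2 Γ
      diameter-2 = proj₁ (proj₂ strict)

  y≁z : ¬ Adj Γ y z
  y≁z y~z with 0<∣p∣⇒Nonempty (subst (0 <_) (sym common⟨x,y⟩≡a) (n≢0⇒n>0 (a≢0 y~z)))
  ... | t , t∈ =
    let (x~t , _) = ∈common⇒Adj t∈
        (z~t , xi~t) = ∈common⇒Adj (N⟨x⟩∩N⟨y⟩⊆N⟨z⟩∩N⟨xi⟩ y~z t∈)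
    in contradiction (subst (λ c → 3 + a ≤ suc c) (b≡1+a y~z) (x~w∧xi~w∧z~w⇒3+a≤1+b x~t xi~t z~t)) (<-irrefl refl)

  N⟨x⟩∩N⟨z⟩⊆N⟨x⟩∩N⟨y⟩ : N Γ x ∩ N Γ z ⊆ N Γ x ∩ N Γ y
  N⟨x⟩∩N⟨z⟩⊆N⟨x⟩∩N⟨y⟩ = common-neighbours-⊆ λ x~w z~w →
    x~w , x~w∧z~w⇒y~w x~w z~w λ { refl → y≁z (Adj-sym z~w) }

  common⟨x,z⟩≡a : common Γ x z ≡ a
  common⟨x,z⟩≡a = common≢b⇒common≡a x≢z (<⇒≢
    (≤-<-trans (p⊆q⇒∣p∣≤∣q∣ N⟨x⟩∩N⟨z⟩⊆N⟨x⟩∩N⟨y⟩) (subst (_< b) (sym common⟨x,y⟩≡a) a<b)))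

  N⟨x⟩∩N⟨y⟩⊆N⟨x⟩∩N⟨z⟩ : N Γ x ∩ N Γ y ⊆ N Γ x ∩ N Γ z
  N⟨x⟩∩N⟨y⟩⊆N⟨x⟩∩N⟨z⟩ = p⊆q∧∣q∣≤∣p∣⇒q⊆p N⟨x⟩∩N⟨z⟩⊆N⟨x⟩∩N⟨y⟩
    (≤-reflexive (trans common⟨x,y⟩≡a (sym common⟨x,z⟩≡a)))

  same-common-neighbours : ∀ w → (Adj Γ x w × Adj Γ y w → Adj Γ x w × Adj Γ z w)
                               × (Adj Γ x w × Adj Γ z w → Adj Γ x w × Adj Γ y w)
  same-common-neighbours w =
    ∈common⇒Adj ∘ N⟨x⟩∩N⟨y⟩⊆N⟨x⟩∩N⟨z⟩ ∘ uncurry Adj⇒∈common ,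
    ∈common⇒Adj ∘ N⟨x⟩∩N⟨z⟩⊆N⟨x⟩∩N⟨y⟩ ∘ uncurry Adj⇒∈common

  module _ {u v} (x~v : Adj Γ x v) (y~v : Adj Γ y v) (u∈B⟨v⟩ : InB Γ b v u) where

    sees-one-of-two : ∀ {w w′} → Adj Γ w v → Adj Γ w′ v → w ≢ w′ → ¬ Adj Γ w u → Adj Γ w′ u
    sees-one-of-two {w} {w′} w~v w′~v w≢w′ w≁u = decidable-stable (Adj? w′ u) λ w′≁u →
      w≢w′ (unshared-neighbour-unique regular u∈B⟨v⟩ (Adj-sym w~v) (Adj-sym w′~v) (w≁u ∘ Adj-sym) (w′≁u ∘ Adj-sym))

    xi~v : Adj Γ xi v
    xi~v = x~w⇒xi~w x~v (≢-sym (Adj⇒≢ y~v))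

    z~v : Adj Γ z v
    z~v = proj₂ (proj₁ (same-common-neighbours v) (x~v , y~v))

    B⟨v⟩-vertex-sees-x-and-y : Adj Γ x u × Adj Γ y u
    B⟨v⟩-vertex-sees-x-and-y with Adj? xi u
    ... | no  xi≁u = sees-one-of-two xi~v x~v (≢-sym x≢xi) xi≁u , sees-one-of-two xi~v y~v (≢-sym y≢xi) xi≁u
    ... | yes xi~u = x~u , decidable-stable (Adj? y u) λ y≁u →
          y≁u (x~w∧z~w⇒y~w x~u (sees-one-of-two y~v z~v y≢z y≁u) λ { refl → y≁xi (Adj-sym xi~u) })
      where
      u≢z : u ≢ z
      u≢z refl = y≁z (sees-one-of-two x~v y~v x≢y x≁z)
      x~u : Adj Γ x u
      x~u = xi~w⇒x~w xi~u u≢z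

  B[v]⊆N⟨x⟩∩N⟨y⟩ : ∀ v → Adj Γ x v × Adj Γ y v → ∀ u → InB[] Γ b v u → Adj Γ x u × Adj Γ y u
  B[v]⊆N⟨x⟩∩N⟨y⟩ v x~v,y~v          u (inj₁ refl)    = x~v,y~v
  B[v]⊆N⟨x⟩∩N⟨y⟩ v (x~v , y~v) u (inj₂ u∈B⟨v⟩) = B⟨v⟩-vertex-sees-x-and-y x~v y~v u∈B⟨v⟩

lemma8 : ∀ {n : ℕ} (Γ : Graph n) (k b a : ℕ) →
    IsStrictlyDeza Γ k b a → k ≡ suc b → (∀ v → 1 < beta Γ b v) →
    (x y xi z : Fin n) → TypeA Γ b x →
    Adj Γ x y → InB Γ b x xi → ¬ Adj Γ y xi →
    Dist2 Γ x z → Adj Γ z xi →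
    (∀ w → (Adj Γ x w × Adj Γ y w → Adj Γ x w × Adj Γ z w)
         × (Adj Γ x w × Adj Γ z w → Adj Γ x w × Adj Γ y w))
    × (∀ v → Adj Γ x v × Adj Γ y v →
         ∀ u → InB[] Γ b v u → Adj Γ x u × Adj Γ y u)
lemma8 Γ k b a strict k≡1+b _ x y xi z typeA x~y xi∈B⟨x⟩ y≁xi z∈N₂⟨x⟩ z~xi =
  same-common-neighbours , B[v]⊆N⟨x⟩∩N⟨y⟩
  where open Configuration Γ strict k≡1+b typeA x~y xi∈B⟨x⟩ y≁xi z∈N₂⟨x⟩ z~xi
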